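{- The permutation matrices $I_2$ and $J_2$ are shape-equivalent for $1$-alternating AD-Young diagrams, i.e. $|S_{\mathcal{Y}}(I_2)|=|S_{\mathcal{Y}}(J_2)|$ for every $1$-alternating AD-Young diagram $\mathcal{Y}$.
   Context: $I_2=\begin{bmatrix}1&0\\0&1\end{bmatrix}$, $J_2=\begin{bmatrix}0&1\\1&0\end{bmatrix}$. Young diagrams are in English notation with matrix coordinates: $Y=(Y_1\ge\cdots\ge Y_k)$ with $k$ rows consists of squares $(i,j)$, $1\le i\le k$, $1\le j\le Y_i$, with $Y_1=k$. An AD-Young diagram is $(Y,A,D)$ with $A,D$ disjoint subsets of $[k-1]$ such that rows $i,i+1$ of $Y$ have equal length whenever $i\in A\cup D$. It is $1$-alternating if for every integer $i$ with $0\le i\le k-1$: $i\in A$ iff $i+1\in D$. A transversal of $Y$ is a set $T=\{(i,t_i)\}$ of squares of $Y$ with exactly one in each row and each column; it is valid for $(Y,A,D)$ if $t_i<t_{i+1}$ for all $i\in A$ and $t_i>t_{i+1}$ for all $i\in D$. For an $r\times r$ permutation matrix $M$, $T$ contains $M$ if there are rows $a_1<\cdots<a_r$ and columns $b_1<\cdots<b_r$ with $(a_r,b_r)\in Y$ such that $(a_i,b_j)\in T$ iff $M_{ij}=1$; otherwise $T$ avoids $M$. $S_{\mathcal{Y}}(M)$ is the set of valid transversals of $\mathcal{Y}$ avoiding $M$. -}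

module Defs where

open import Data.Nat using (ℕ; zero; suc; _+_; _∸_; _≤_; _≤ᵇ_; _<ᵇ_; _≡ᵇ_)
open import Data.Bool using (Bool; true; false; _∧_; _∨_; not; if_then_else_)
open import Data.Bool.ListAction using (all; any)
open import Data.List using (List; []; _∷_; map; upTo; concatMap; length; filter)
open import Data.Fin using (Fin; zero; suc; _≟_)
open import Data.Product using (_×_)
open import Data.Empty using (⊥)
open import Function.Bundles using (_⇔_)
open import Relation.Binary.PropositionalEquality using (_≡_)
open import Relation.Nullary.Decidable using (⌊_⌋)
import Data.Bool as B

-- Rows and columns are 1-based natural numbers, as in the
-- paper.  A Young diagram with k rows is given by k : ℕ and a function
-- Y : ℕ → ℕ, where Y i is the length of row i (only 1 ≤ i ≤ k matters).
-- Subsets A, D of [k-1] are given by membership functions ℕ → Bool.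

-- the list [a, a+1, ..., b]  (empty if b < a)
range : ℕ → ℕ → List ℕ
range a b = map (a +_) (upTo (suc b ∸ a))

forallIn : ℕ → ℕ → (ℕ → Bool) → Bool
forallIn a b p = all p (range a b)

existsIn : ℕ → ℕ → (ℕ → Bool) → Bool
existsIn a b p = any p (range a b)

countIn : ℕ → ℕ → (ℕ → Bool) → ℕ
countIn a b p = length (filter (λ x → p x B.≟ true) (range a b))

IsYoung : ℕ → (ℕ → ℕ) → Set
IsYoung k Y =
  ((i j : ℕ) → 1 ≤ i → i ≤ j → j ≤ k → Y j ≤ Y i)
  × ((i : ℕ) → 1 ≤ i → i ≤ k → 1 ≤ Y i)
  × (Y 1 ≡ k)

IsADYoung : ℕ → (ℕ → ℕ) → (ℕ → Bool) → (ℕ → Bool) → Set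
IsADYoung k Y A D =
  IsYoung k Y
  × ((i : ℕ) → A i ≡ true → (1 ≤ i) × (i + 1 ≤ k))
  × ((i : ℕ) → D i ≡ true → (1 ≤ i) × (i + 1 ≤ k))
  × ((i : ℕ) → A i ≡ true → D i ≡ true → ⊥)
  × ((i : ℕ) → A i ∨ D i ≡ true → Y i ≡ Y (suc i))

IsOneAlternating : ℕ → (ℕ → Bool) → (ℕ → Bool) → Set
IsOneAlternating k A D = (i : ℕ) → i + 1 ≤ k → (A i ≡ true ⇔ D (suc i) ≡ true)

memY : ℕ → (ℕ → ℕ) → ℕ → ℕ → Bool
memY k Y i j = (1 ≤ᵇ i) ∧ (i ≤ᵇ k) ∧ (1 ≤ᵇ j) ∧ (j ≤ᵇ Y i)

-- A set T of squares with exactly one square in each of the rows 1..k is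
-- encoded by the list t = [t_1, …, t_k] of its columns: T = {(i, t_i)}.
-- col t i = t_i (1-based; 0 outside the list).
col : List ℕ → ℕ → ℕ
col []       _             = 0
col (x ∷ xs) zero          = 0
col (x ∷ xs) (suc zero)    = x
col (x ∷ xs) (suc (suc n)) = col xs (suc n)

inT : ℕ → List ℕ → ℕ → ℕ → Bool
inT k t a b = (1 ≤ᵇ a) ∧ (a ≤ᵇ k) ∧ (col t a ≡ᵇ b)

isTransversal : ℕ → (ℕ → ℕ) → List ℕ → Bool
isTransversal k Y t =
  (length t ≡ᵇ k)
  ∧ forallIn 1 k (λ i → memY k Y i (col t i))
  ∧ forallIn 1 (Y 1) (λ j → countIn 1 k (λ i → col t i ≡ᵇ j) ≡ᵇ 1)

isValid : ℕ → (ℕ → Bool) → (ℕ → Bool) → List ℕ → Bool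
isValid k A D t =
  forallIn 1 (k ∸ 1) (λ i →
    (not (A i) ∨ (col t i <ᵇ col t (suc i)))
    ∧ (not (D i) ∨ (col t (suc i) <ᵇ col t i)))

-- 2×2 (0/1) matrices, indexed by Fin 2 (zero ↦ 1, suc zero ↦ 2)
Mat₂ : Set
Mat₂ = Fin 2 → Fin 2 → Bool

I₂ : Mat₂
I₂ i j = ⌊ i ≟ j ⌋

J₂ : Mat₂
J₂ i j = not ⌊ i ≟ j ⌋

pick : ℕ → ℕ → Fin 2 → ℕ
pick x y zero       = x
pick x y (suc zero) = y

_==_ : Bool → Bool → Bool
x == y = ⌊ x B.≟ y ⌋

all₂ : (Fin 2 → Bool) → Bool
all₂ p = p zero ∧ p (suc zero)

-- T contains the 2×2 matrix M: there are rows a₁ < a₂ and columns b₁ < b₂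
-- with (a₂, b₂) ∈ Y such that (a_i, b_j) ∈ T iff M_ij = 1.
-- (Rows/columns are positive integers; the ranges below are exact, since
-- (a₂,b₂) ∈ Y forces a₂ ≤ k and b₁ < b₂ ≤ Y_{a₂}.)
contains₂ : ℕ → (ℕ → ℕ) → List ℕ → Mat₂ → Bool
contains₂ k Y t M =
  existsIn 1 k λ a₁ → existsIn 1 k λ a₂ →
  existsIn 1 (Y a₂) λ b₁ → existsIn 1 (Y a₂) λ b₂ →
    (a₁ <ᵇ a₂) ∧ (b₁ <ᵇ b₂) ∧ memY k Y a₂ b₂
    ∧ all₂ (λ i → all₂ (λ j →
         inT k t (pick a₁ a₂ i) (pick b₁ b₂ j) == M i j))

-- all column lists [t_1,…,t_k] with 1 ≤ t_i ≤ Y_i (every transversal of Y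
-- is encoded by exactly one of them)
seqs : List ℕ → List (List ℕ)
seqs []       = [] ∷ []
seqs (y ∷ ys) = concatMap (λ c → map (c ∷_) (seqs ys)) (range 1 y)

candidates : ℕ → (ℕ → ℕ) → List (List ℕ)
candidates k Y = seqs (map Y (range 1 k))

countS : ℕ → (ℕ → ℕ) → (ℕ → Bool) → (ℕ → Bool) → Mat₂ → ℕ
countS k Y A D M =
  length (filter (λ t → (isTransversal k Y t ∧ isValid k A D t
                         ∧ not (contains₂ k Y t M)) B.≟ true)
                 (candidates k Y))

module Submission where

-- If some i lies in A, 1-alternation puts i + 1 in D, and the rows i, i + 1,
-- i + 2 force every valid transversal to contain both I₂ and J₂: both counts
-- are 0.  Otherwise A and D are empty, validity is vacuous, and each pattern
-- is avoided by exactly one transversal when Y has any transversal at all.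
-- Both patterns are detected by a ranking ρ of the rows (the natural order
-- for I₂, the reverse one for J₂): a transversal contains the pattern iff it
-- has an ascent, rows i ranked before a with t_i < t_a and (i, t_a) ∈ Y.
-- Exchanging the columns of an ascent lowers the weight Σ ρ(i)·t_i (the
-- rearrangement inequality), so descent produces an avoider; two avoiders
-- agree row by row along ρ, so it is unique.

open import Defs
open import Data.Bool using (Bool; true; false; T; _∧_; _∨_; not)
open import Data.Bool.Properties using (T-≡; ∨-zeroʳ)
import Data.Bool as B
open import Data.Empty using (⊥-elim)
open import Data.Fin using (Fin; zero; suc)
open import Data.List using (List; []; _∷_; _++_; map; applyUpTo; length; filter; cartesianProductWith; concatMap)
open import Data.List.Membership.Propositional using (_∈_; find; lose)
open import Data.List.Membership.Propositional.Properties
  using (∈-map⁺; ∈-map⁻; ∈-upTo⁺; ∈-upTo⁻; ∈-filter⁺; ∈-filter⁻; ∈-cartesianProductWith⁺)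
open import Data.List.Properties
  using (filter-none; filter-accept; filter-reject; ∷-injective; map-applyUpTo; length-applyUpTo; map-cong-local)
open import Data.List.Relation.Unary.All as All using (All)
open import Data.List.Relation.Unary.All.Properties using (all⁺; all⁻)
import Data.List.Relation.Unary.AllPairs as AllPairs
open import Data.List.Relation.Unary.Any using (here; there; any?)
open import Data.List.Relation.Unary.Any.Properties using (any⇔)
open import Data.List.Relation.Unary.Unique.Propositional using (Unique)
import Data.List.Relation.Unary.Unique.Propositional.Properties as Unique
open import Data.Nat using (ℕ; zero; suc; _+_; _*_; _∸_; _≤_; _<_; _≤ᵇ_; _<ᵇ_; _≡ᵇ_; _≟_; z≤n; s≤s; s≤s⁻¹)
open import Data.Nat.Induction using (<-wellFounded)
open import Data.Nat.ListAction using (sum)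
open import Data.Nat.Properties
open import Data.Nat.Tactic.RingSolver using (solve-∀)
open import Data.Product using (_×_; _,_; proj₁; proj₂; ∃-syntax)
open import Function using (_∘_)
open import Function.Bundles using (_⇔_; mk⇔; Equivalence)
open import Induction.WellFounded using (Acc; acc)
open import Relation.Binary.Definitions using (tri<; tri≈; tri>)
open import Relation.Binary.PropositionalEquality
open import Relation.Nullary using (¬_; yes; no)
open import Relation.Nullary.Decidable using (T?; toWitness; fromWitness)

open Equivalence using (to; from)
open ≡-Reasoning

∧-split : ∀ x {y} → T (x ∧ y) → T x × T y
∧-split true ty = _ , ty

∧-join : ∀ {x y} → T x → T y → T (x ∧ y)
∧-join {true} _ ty = ty

Row : ℕ → ℕ → Set
Row n i = 1 ≤ i × i ≤ n

∈-range : ∀ {n x} → x ∈ range 1 n ⇔ Row n x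
∈-range {n} = mk⇔ into onto
  where
    into : ∀ {x} → x ∈ range 1 n → Row n x
    into x∈ with j , j∈ , refl ← ∈-map⁻ suc x∈ = s≤s z≤n , ∈-upTo⁻ j∈
    onto : ∀ {x} → Row n x → x ∈ range 1 n
    onto {suc j} (_ , j<n) = ∈-map⁺ suc (∈-upTo⁺ j<n)

range-unique : ∀ n → Unique (range 1 n)
range-unique n = Unique.map⁺ suc-injective (Unique.upTo⁺ n)

forallIn⇔ : ∀ n p → T (forallIn 1 n p) ⇔ (∀ {i} → Row n i → T (p i))
forallIn⇔ n p = mk⇔ into onto
  where
    into : T (forallIn 1 n p) → ∀ {i} → Row n i → T (p i)
    into h r = All.lookup (all⁺ p _ h) (from ∈-range r)
    onto : (∀ {i} → Row n i → T (p i)) → T (forallIn 1 n p)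
    onto h = all⁻ p (All.tabulate (λ i∈ → h (to ∈-range i∈)))

existsIn⇔ : ∀ n p → T (existsIn 1 n p) ⇔ (∃[ i ] Row n i × T (p i))
existsIn⇔ n p = mk⇔ into onto
  where
    into : T (existsIn 1 n p) → ∃[ i ] Row n i × T (p i)
    into h = let i , i∈ , pi = find (from any⇔ h) in i , to ∈-range i∈ , pi
    onto : ∃[ i ] Row n i × T (p i) → T (existsIn 1 n p)
    onto (i , r , pi) = to any⇔ (lose (from ∈-range r) pi)

count : {A : Set} → (A → Bool) → List A → ℕ
count q xs = length (filter (λ x → q x B.≟ true) xs)

AtMostOne : {A : Set} → (A → Bool) → List A → Set
AtMostOne q xs = ∀ {x y} → x ∈ xs → y ∈ xs → T (q x) → T (q y) → x ≡ y

module _ {A : Set} (q : A → Bool) where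

  count≡0 : ∀ {xs} → (∀ {x} → x ∈ xs → ¬ T (q x)) → count q xs ≡ 0
  count≡0 none = cong length (filter-none (λ x → q x B.≟ true)
                   (All.tabulate (λ x∈ qx → none x∈ (from T-≡ qx))))

  count≡1 : ∀ {xs x} → Unique xs → x ∈ xs → T (q x) →
            (∀ {y} → y ∈ xs → T (q y) → y ≡ x) → count q xs ≡ 1
  count≡1 {y ∷ ys} (y∉ys AllPairs.∷ _) (here refl) qy only =
    trans (cong length (filter-accept (λ x → q x B.≟ true) (to T-≡ qy)))
          (cong suc (count≡0 (λ z∈ qz → All.lookup y∉ys z∈ (sym (only (there z∈) qz)))))
  count≡1 {y ∷ ys} (y∉ys AllPairs.∷ unique) (there x∈) qx only =
    trans (cong length (filter-reject (λ x → q x B.≟ true) y-fails))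
          (count≡1 unique x∈ qx (only ∘ there))
    where
      y-fails : ¬ q y ≡ true
      y-fails qy = All.lookup y∉ys x∈ (only (here refl) (from T-≡ qy))

  count≡1⁻ : ∀ {xs} → count q xs ≡ 1 →
             ∃[ x ] x ∈ xs × T (q x) × (∀ {y} → y ∈ xs → T (q y) → y ≡ x)
  count≡1⁻ {xs} c with filter (λ x → q x B.≟ true) xs in eq
  ... | x ∷ [] = x , proj₁ x-selected , from T-≡ (proj₂ x-selected) , only
    where
      x-selected : x ∈ xs × q x ≡ true
      x-selected = ∈-filter⁻ (λ x → q x B.≟ true) (subst (x ∈_) (sym eq) (here refl))
      only : ∀ {y} → y ∈ xs → T (q y) → y ≡ x
      only y∈ qy with subst (_ ∈_) eq (∈-filter⁺ (λ x → q x B.≟ true) y∈ (to T-≡ qy))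
      ... | here y≡x = y≡x

count-equal : {A : Set} (q₁ q₂ : A → Bool) {xs : List A} → Unique xs →
              AtMostOne q₁ xs → AtMostOne q₂ xs →
              (∀ {x} → x ∈ xs → T (q₁ x) → ∃[ y ] y ∈ xs × T (q₂ y)) →
              (∀ {y} → y ∈ xs → T (q₂ y) → ∃[ x ] x ∈ xs × T (q₁ x)) →
              count q₁ xs ≡ count q₂ xs
count-equal q₁ q₂ {xs} unique one₁ one₂ 1⇒2 2⇒1 with any? (T? ∘ q₁) xs
... | yes some₁ =
  let x , x∈ , q₁x = find some₁
      y , y∈ , q₂y = 1⇒2 x∈ q₁x
  in trans (count≡1 q₁ unique x∈ q₁x (λ z∈ q₁z → one₁ z∈ x∈ q₁z q₁x))
           (sym (count≡1 q₂ unique y∈ q₂y (λ z∈ q₂z → one₂ z∈ y∈ q₂z q₂y)))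
... | no none₁ =
  trans (count≡0 q₁ (λ x∈ q₁x → none₁ (lose x∈ q₁x)))
        (sym (count≡0 q₂ (λ y∈ q₂y → let _ , x∈ , q₁x = 2⇒1 y∈ q₂y in none₁ (lose x∈ q₁x))))

columns : ℕ → (ℕ → ℕ) → List ℕ
columns k τ = applyUpTo (τ ∘ suc) k

col-columns : ∀ {k i} τ → Row k i → col (columns k τ) i ≡ τ i
col-columns {k} τ (s≤s {n = p} z≤n , p<k) = go (τ ∘ suc) k p p<k
  where
    go : ∀ h n p → p < n → col (applyUpTo h n) (suc p) ≡ h p
    go h (suc n) zero    _         = refl
    go h (suc n) (suc p) (s≤s p<n) = go (h ∘ suc) n p p<n

col-ext : ∀ {n} (t t′ : List ℕ) → length t ≡ n → length t′ ≡ n →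
          (∀ {i} → Row n i → col t i ≡ col t′ i) → t ≡ t′
col-ext []      []        _    _     _     = refl
col-ext []      (_ ∷ _)   refl ()   _
col-ext (x ∷ t) (x′ ∷ t′) refl len′ agree =
  cong₂ _∷_ (agree (s≤s z≤n , s≤s z≤n))
            (col-ext t t′ refl (suc-injective len′) shifted)
  where
    shifted : ∀ {i} → Row (length t) i → col t i ≡ col t′ i
    shifted {suc p} (_ , i≤n) = agree (s≤s z≤n , s≤s i≤n)

young-mono : ∀ {k Y i j} → IsYoung k Y → Row k i → i ≤ j → j ≤ k → Y j ≤ Y i
young-mono (mono , _) (1≤i , _) i≤j j≤k = mono _ _ 1≤i i≤j j≤k

young-bound : ∀ {k Y i} → IsYoung k Y → Row k i → Y i ≤ k
young-bound young@(_ , _ , Y1≡k) (1≤i , i≤k) =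
  subst (_ ≤_) Y1≡k (young-mono young (≤-refl , ≤-trans 1≤i i≤k) 1≤i i≤k)

memY⇔ : ∀ {k Y i j} → T (memY k Y i j) ⇔ (Row k i × Row (Y i) j)
memY⇔ {k} {Y} {i} {j} = mk⇔ into onto
  where
    into : T (memY k Y i j) → Row k i × Row (Y i) j
    into h = let a , h′ = ∧-split (1 ≤ᵇ i) h ; b , h″ = ∧-split (i ≤ᵇ k) h′ ; c , d = ∧-split (1 ≤ᵇ j) h″
             in (≤ᵇ⇒≤ 1 i a , ≤ᵇ⇒≤ i k b) , (≤ᵇ⇒≤ 1 j c , ≤ᵇ⇒≤ j (Y i) d)
    onto : Row k i × Row (Y i) j → T (memY k Y i j)
    onto ((a , b) , (c , d)) =
      ∧-join (≤⇒≤ᵇ a) (∧-join (≤⇒≤ᵇ b) (∧-join (≤⇒≤ᵇ c) (≤⇒≤ᵇ d)))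

record IsTransversal (k : ℕ) (Y : ℕ → ℕ) (t : List ℕ) : Set where
  field
    length≡    : length t ≡ k
    inY        : ∀ {i} → Row k i → Row (Y i) (col t i)
    surjective : ∀ {j} → Row k j → ∃[ i ] Row k i × col t i ≡ j
    injective  : ∀ {i i′} → Row k i → Row k i′ → col t i ≡ col t i′ → i ≡ i′

open IsTransversal

column-range : ∀ {k Y t i} → IsYoung k Y → IsTransversal k Y t → Row k i → Row k (col t i)
column-range young tr r = proj₁ (inY tr r) , ≤-trans (proj₂ (inY tr r)) (young-bound young r)

module _ {k : ℕ} {Y : ℕ → ℕ} {t : List ℕ} (young : IsYoung k Y) where

  private
    hits : ℕ → ℕ → Bool
    hits j i = col t i ≡ᵇ j

    lengthTest squaresTest columnsTest : Bool
    lengthTest  = length t ≡ᵇ k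
    squaresTest = forallIn 1 k (λ i → memY k Y i (col t i))
    columnsTest = forallIn 1 (Y 1) (λ j → count (hits j) (range 1 k) ≡ᵇ 1)

    Y1≡k : Y 1 ≡ k
    Y1≡k = proj₂ (proj₂ young)

  test-sound : T (isTransversal k Y t) → IsTransversal k Y t
  test-sound h = record { length≡ = ≡ᵇ⇒≡ _ k lengthOk ; inY = inY′ ; surjective = surjective′ ; injective = injective′ }
    where
      lengthOk : T lengthTest
      lengthOk = proj₁ (∧-split lengthTest h)
      squaresOk : T squaresTest
      squaresOk = proj₁ (∧-split squaresTest (proj₂ (∧-split lengthTest h)))
      columnsOk : T columnsTest
      columnsOk = proj₂ (∧-split squaresTest (proj₂ (∧-split lengthTest h)))
      inY′ : ∀ {i} → Row k i → Row (Y i) (col t i)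
      inY′ {i} r = proj₂ (to (memY⇔ {k} {Y} {i}) (to (forallIn⇔ k _) squaresOk r))
      single : ∀ {j} → Row k j →
               ∃[ i ] i ∈ range 1 k × T (hits j i) × (∀ {i′} → i′ ∈ range 1 k → T (hits j i′) → i′ ≡ i)
      single {j} r = count≡1⁻ (hits j)
        (≡ᵇ⇒≡ _ 1 (to (forallIn⇔ (Y 1) _) columnsOk (subst (λ m → Row m j) (sym Y1≡k) r)))
      surjective′ : ∀ {j} → Row k j → ∃[ i ] Row k i × col t i ≡ j
      surjective′ r = let i , i∈ , hit , _ = single r in i , to ∈-range i∈ , ≡ᵇ⇒≡ _ _ hit
      injective′ : ∀ {i i′} → Row k i → Row k i′ → col t i ≡ col t i′ → i ≡ i′
      injective′ {i} {i′} r r′ same =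
        let c = inY′ r ; _ , _ , _ , only = single (proj₁ c , ≤-trans (proj₂ c) (young-bound young r))
        in trans (only (from ∈-range r) (≡⇒≡ᵇ (col t i) _ refl))
                 (sym (only (from ∈-range r′) (≡⇒≡ᵇ _ _ (sym same))))

  test-complete : IsTransversal k Y t → T (isTransversal k Y t)
  test-complete tr = ∧-join (≡⇒≡ᵇ _ k (length≡ tr)) (∧-join squaresOk columnsOk)
    where
      squaresOk : T squaresTest
      squaresOk = from (forallIn⇔ k _) (λ {i} r → from (memY⇔ {k} {Y} {i}) (r , inY tr r))
      exactlyOnce : ∀ {j} → Row k j → count (hits j) (range 1 k) ≡ 1
      exactlyOnce r =
        let i , ri , ti≡j = surjective tr r
        in count≡1 _ (range-unique k) (from ∈-range ri) (≡⇒≡ᵇ _ _ ti≡j)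
             (λ i′∈ hit → injective tr (to ∈-range i′∈) ri (trans (≡ᵇ⇒≡ _ _ hit) (sym ti≡j)))
      columnsOk : T columnsTest
      columnsOk = from (forallIn⇔ (Y 1) _)
        (λ r → ≡⇒≡ᵇ _ 1 (exactlyOnce (subst (λ m → Row m _) Y1≡k r)))

  isTransversal⇔ : T (isTransversal k Y t) ⇔ IsTransversal k Y t
  isTransversal⇔ = mk⇔ test-sound test-complete

seqs-product : ∀ y ys → seqs (y ∷ ys) ≡ cartesianProductWith _∷_ (range 1 y) (seqs ys)
seqs-product y ys = go (range 1 y)
  where
    go : ∀ cs → concatMap (λ c → map (c ∷_) (seqs ys)) cs ≡ cartesianProductWith _∷_ cs (seqs ys)
    go []       = refl
    go (c ∷ cs) = cong (map (c ∷_) (seqs ys) ++_) (go cs)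

seqs-unique : ∀ ls → Unique (seqs ls)
seqs-unique []       = All.[] AllPairs.∷ AllPairs.[]
seqs-unique (y ∷ ys) = subst Unique (sym (seqs-product y ys))
  (Unique.cartesianProductWith⁺ _∷_ ∷-injective (range-unique y) (seqs-unique ys))

∈-seqs : ∀ {n} τ t → length t ≡ n → (∀ {i} → Row n i → Row (τ i) (col t i)) → t ∈ seqs (columns n τ)
∈-seqs τ []      refl fits = here refl
∈-seqs τ (c ∷ t) refl fits =
  subst (c ∷ t ∈_) (sym (seqs-product (τ 1) (columns (length t) (τ ∘ suc))))
    (∈-cartesianProductWith⁺ _∷_ (from ∈-range (fits (s≤s z≤n , s≤s z≤n)))
                                 (∈-seqs (τ ∘ suc) t refl (λ { {suc i} (_ , i<n) → fits (s≤s z≤n , s≤s i<n) })))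

candidates-columns : ∀ k Y → candidates k Y ≡ seqs (columns k Y)
candidates-columns k Y = cong seqs (trans (cong (map Y) (map-applyUpTo (λ i → i) suc k))
                                          (map-applyUpTo suc Y k))

candidates-unique : ∀ k Y → Unique (candidates k Y)
candidates-unique k Y = seqs-unique (map Y (range 1 k))

transversal∈candidates : ∀ {k Y t} → IsTransversal k Y t → t ∈ candidates k Y
transversal∈candidates {k} {Y} {t} tr = subst (t ∈_) (sym (candidates-columns k Y))
  (∈-seqs Y t (length≡ tr) (inY tr))

record Occurrence (k : ℕ) (Y : ℕ → ℕ) (t : List ℕ) (M : Mat₂) : Set where
  field
    a₁ a₂ b₁ b₂ : ℕ
    row₁    : Row k a₁
    row₂    : Row k a₂
    column₁ : Row (Y a₂) b₁
    column₂ : Row (Y a₂) b₂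
    a₁<a₂   : a₁ < a₂
    b₁<b₂   : b₁ < b₂
    entry   : ∀ i j → inT k t (pick a₁ a₂ i) (pick b₁ b₂ j) ≡ M i j

==⇔ : ∀ {x y} → T (x == y) ⇔ x ≡ y
==⇔ = mk⇔ toWitness fromWitness

contains⇔occurrence : ∀ {k Y t M} → T (contains₂ k Y t M) ⇔ Occurrence k Y t M
contains⇔occurrence {k} {Y} {t} {M} = mk⇔ into onto
  where
    entries : ℕ → ℕ → ℕ → ℕ → Bool
    entries a₁ a₂ b₁ b₂ = all₂ (λ i → all₂ (λ j → inT k t (pick a₁ a₂ i) (pick b₁ b₂ j) == M i j))

    entries⇔ : ∀ {a₁ a₂ b₁ b₂} → T (entries a₁ a₂ b₁ b₂) ⇔
               (∀ i j → inT k t (pick a₁ a₂ i) (pick b₁ b₂ j) ≡ M i j)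
    entries⇔ {a₁} {a₂} {b₁} {b₂} = mk⇔ split join
      where
        e : Fin 2 → Fin 2 → Bool
        e i j = inT k t (pick a₁ a₂ i) (pick b₁ b₂ j) == M i j
        split : T (entries a₁ a₂ b₁ b₂) → ∀ i j → inT k t (pick a₁ a₂ i) (pick b₁ b₂ j) ≡ M i j
        split h i j = to ==⇔ (cell (row i) j)
          where
            row : ∀ i → T (all₂ (e i))
            row zero       = proj₁ (∧-split (all₂ (e zero)) h)
            row (suc zero) = proj₂ (∧-split (all₂ (e zero)) h)
            cell : ∀ {i} → T (all₂ (e i)) → ∀ j → T (e i j)
            cell {i} r zero       = proj₁ (∧-split (e i zero) r)
            cell {i} r (suc zero) = proj₂ (∧-split (e i zero) r)
        join : (∀ i j → inT k t (pick a₁ a₂ i) (pick b₁ b₂ j) ≡ M i j) → T (entries a₁ a₂ b₁ b₂)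
        join h = ∧-join (∧-join (from ==⇔ (h zero zero)) (from ==⇔ (h zero (suc zero))))
                        (∧-join (from ==⇔ (h (suc zero) zero)) (from ==⇔ (h (suc zero) (suc zero))))

    into : T (contains₂ k Y t M) → Occurrence k Y t M
    into h =
      let a₁ , row₁ , h₁ = to (existsIn⇔ k _) h
          a₂ , row₂ , h₂ = to (existsIn⇔ k _) h₁
          b₁ , column₁ , h₃ = to (existsIn⇔ (Y a₂) _) h₂
          b₂ , column₂ , h₄ = to (existsIn⇔ (Y a₂) _) h₃
          a₁<a₂ , h₅ = ∧-split (a₁ <ᵇ a₂) h₄
          b₁<b₂ , h₆ = ∧-split (b₁ <ᵇ b₂) h₅
          _ , h₇ = ∧-split (memY k Y a₂ b₂) h₆
      in record { a₁ = a₁ ; a₂ = a₂ ; b₁ = b₁ ; b₂ = b₂ ; row₁ = row₁ ; row₂ = row₂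
                ; column₁ = column₁ ; column₂ = column₂
                ; a₁<a₂ = <ᵇ⇒< a₁ a₂ a₁<a₂ ; b₁<b₂ = <ᵇ⇒< b₁ b₂ b₁<b₂ ; entry = to entries⇔ h₇ }

    onto : Occurrence k Y t M → T (contains₂ k Y t M)
    onto o = from (existsIn⇔ k _) (a₁ , row₁ , from (existsIn⇔ k _) (a₂ , row₂ ,
               from (existsIn⇔ (Y a₂) _) (b₁ , column₁ , from (existsIn⇔ (Y a₂) _) (b₂ , column₂ ,
                 ∧-join (<⇒<ᵇ a₁<a₂) (∧-join (<⇒<ᵇ b₁<b₂)
                   (∧-join (from (memY⇔ {k} {Y} {a₂}) (row₂ , column₂)) (from entries⇔ entry)))))))
      where open Occurrence o

inT⇔ : ∀ {k t r c} → T (inT k t r c) ⇔ (Row k r × col t r ≡ c)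
inT⇔ {k} {t} {r} {c} = mk⇔
  (λ h → let a , h′ = ∧-split (1 ≤ᵇ r) h ; b , e = ∧-split (r ≤ᵇ k) h′
         in (≤ᵇ⇒≤ 1 r a , ≤ᵇ⇒≤ r k b) , ≡ᵇ⇒≡ _ c e)
  (λ ((a , b) , e) → ∧-join (≤⇒≤ᵇ a) (∧-join (≤⇒≤ᵇ b) (≡⇒≡ᵇ _ c e)))

inT-on : ∀ {k t r} → Row k r → inT k t r (col t r) ≡ true
inT-on {k} {t} {r} row = to T-≡ (from (inT⇔ {k} {t} {r}) (row , refl))

inT-off : ∀ {k t r c} → col t r ≢ c → inT k t r c ≡ false
inT-off {k} {t} {r} {c} ne with inT k t r c in eq
... | false = refl
... | true  = ⊥-elim (ne (proj₂ (to (inT⇔ {k} {t} {r}) (from T-≡ eq))))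

inT-col : ∀ {k t r c} → inT k t r c ≡ true → col t r ≡ c
inT-col {k} {t} {r} e = proj₂ (to (inT⇔ {k} {t} {r}) (from T-≡ e))

-- Exchanging the columns of
-- the two rows then gives a transversal again.
record Ascent (k : ℕ) (Y : ℕ → ℕ) (ρ : ℕ → ℕ) (t : List ℕ) : Set where
  field
    i a     : ℕ
    row-i   : Row k i
    row-a   : Row k a
    ranked  : ρ i < ρ a
    smaller : col t i < col t a
    fits    : col t a ≤ Y i

record Detects (k : ℕ) (Y : ℕ → ℕ) (M : Mat₂) (ρ : ℕ → ℕ) : Set where
  field
    ρ-injective : ∀ {i a} → Row k i → Row k a → ρ i ≡ ρ a → i ≡ a
    occurrence⇔ascent : ∀ {t} → IsTransversal k Y t → Occurrence k Y t M ⇔ Ascent k Y ρ t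

  contains⇔ascent : ∀ {t} → IsTransversal k Y t → T (contains₂ k Y t M) ⇔ Ascent k Y ρ t
  contains⇔ascent tr = mk⇔ (to (occurrence⇔ascent tr) ∘ to contains⇔occurrence)
                           (from contains⇔occurrence ∘ from (occurrence⇔ascent tr))

I₂-detected : ∀ {k Y} → IsYoung k Y → Detects k Y I₂ (λ i → i)
I₂-detected {k} {Y} young = record { ρ-injective = λ _ _ e → e ; occurrence⇔ascent = λ tr → mk⇔ ascent (occurrence tr) }
  where
    ascent : ∀ {t} → Occurrence k Y t I₂ → Ascent k Y (λ i → i) t
    ascent {t} o = record
      { i = a₁ ; a = a₂ ; row-i = row₁ ; row-a = row₂ ; ranked = a₁<a₂
      ; smaller = subst₂ _<_ (sym t₁≡b₁) (sym t₂≡b₂) b₁<b₂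
      ; fits = subst (_≤ Y a₁) (sym t₂≡b₂)
                 (≤-trans (proj₂ column₂) (young-mono young row₁ (<⇒≤ a₁<a₂) (proj₂ row₂))) }
      where
        open Occurrence o
        t₁≡b₁ : col t a₁ ≡ b₁
        t₁≡b₁ = inT-col {k} {t} (entry zero zero)
        t₂≡b₂ : col t a₂ ≡ b₂
        t₂≡b₂ = inT-col {k} {t} (entry (suc zero) (suc zero))
    occurrence : ∀ {t} → IsTransversal k Y t → Ascent k Y (λ i → i) t → Occurrence k Y t I₂
    occurrence {t} tr asc = record
      { a₁ = i ; a₂ = a ; b₁ = col t i ; b₂ = col t a ; row₁ = row-i ; row₂ = row-a
      ; column₁ = proj₁ (inY tr row-i) , ≤-trans (<⇒≤ smaller) (proj₂ (inY tr row-a))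
      ; column₂ = inY tr row-a ; a₁<a₂ = ranked ; b₁<b₂ = smaller ; entry = entry }
      where
        open Ascent asc
        entry : ∀ r c → inT k t (pick i a r) (pick (col t i) (col t a) c) ≡ I₂ r c
        entry zero       zero       = inT-on {k} {t} row-i
        entry zero       (suc zero) = inT-off {k} {t} {i} (<⇒≢ smaller)
        entry (suc zero) zero       = inT-off {k} {t} {a} (≢-sym (<⇒≢ smaller))
        entry (suc zero) (suc zero) = inT-on {k} {t} row-a

J₂-detected : ∀ {k Y} → Detects k Y J₂ (k ∸_)
J₂-detected {k} {Y} = record
  { ρ-injective = λ r r′ → ∸-cancelˡ-≡ (proj₂ r) (proj₂ r′)
  ; occurrence⇔ascent = λ tr → mk⇔ ascent (occurrence tr) }
  where
    ascent : ∀ {t} → Occurrence k Y t J₂ → Ascent k Y (k ∸_) t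
    ascent {t} o = record
      { i = a₂ ; a = a₁ ; row-i = row₂ ; row-a = row₁
      ; ranked = ∸-monoʳ-< a₁<a₂ (proj₂ row₂)
      ; smaller = subst₂ _<_ (sym t₂≡b₁) (sym t₁≡b₂) b₁<b₂
      ; fits = subst (_≤ Y a₂) (sym t₁≡b₂) (proj₂ column₂) }
      where
        open Occurrence o
        t₁≡b₂ : col t a₁ ≡ b₂
        t₁≡b₂ = inT-col {k} {t} (entry zero (suc zero))
        t₂≡b₁ : col t a₂ ≡ b₁
        t₂≡b₁ = inT-col {k} {t} (entry (suc zero) zero)
    occurrence : ∀ {t} → IsTransversal k Y t → Ascent k Y (k ∸_) t → Occurrence k Y t J₂
    occurrence {t} tr asc = record
      { a₁ = a ; a₂ = i ; b₁ = col t i ; b₂ = col t a ; row₁ = row-a ; row₂ = row-i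
      ; column₁ = inY tr row-i ; column₂ = proj₁ (inY tr row-a) , fits
      ; a₁<a₂ = ≰⇒> (λ i≤a → <⇒≱ ranked (∸-monoʳ-≤ k i≤a)) ; b₁<b₂ = smaller ; entry = entry }
      where
        open Ascent asc
        entry : ∀ r c → inT k t (pick a i r) (pick (col t i) (col t a) c) ≡ J₂ r c
        entry zero       zero       = inT-off {k} {t} {a} (≢-sym (<⇒≢ smaller))
        entry zero       (suc zero) = inT-on {k} {t} row-a
        entry (suc zero) zero       = inT-on {k} {t} row-i
        entry (suc zero) (suc zero) = inT-off {k} {t} {i} (<⇒≢ smaller)

-- Induction along ρ: if t and t′ agree on the rows ranked before i
-- but t_i < t′_i, the row a of t holding column t′_i is ranked after i, and
-- (i, a) is an ascent of t.
module _ {k : ℕ} {Y : ℕ → ℕ} {ρ : ℕ → ℕ} (young : IsYoung k Y)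
         (ρ-injective : ∀ {i a} → Row k i → Row k a → ρ i ≡ ρ a → i ≡ a) where

  private
    AgreeBefore : List ℕ → List ℕ → ℕ → Set
    AgreeBefore u u′ i = ∀ {r} → Row k r → ρ r < ρ i → col u r ≡ col u′ r

    no-first-difference : ∀ {u u′ i} → IsTransversal k Y u → IsTransversal k Y u′ →
                          ¬ Ascent k Y ρ u → Row k i → AgreeBefore u u′ i → ¬ col u i < col u′ i
    no-first-difference {u} {u′} {i} tr tr′ ascent-free row-i agree u<u′
      with a , row-a , uₐ≡u′ᵢ ← surjective tr (column-range young tr′ row-i)
      with <-cmp (ρ a) (ρ i)
    ... | tri< a-before _ _ =
      <-irrefl (cong ρ (injective tr′ row-a row-i (trans (sym (agree row-a a-before)) uₐ≡u′ᵢ))) a-before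
    ... | tri≈ _ same _ =
      <-irrefl (trans (cong (col u) (sym (ρ-injective row-a row-i same))) uₐ≡u′ᵢ) u<u′
    ... | tri> _ _ i-before = ascent-free record
      { i = i ; a = a ; row-i = row-i ; row-a = row-a ; ranked = i-before
      ; smaller = subst (col u i <_) (sym uₐ≡u′ᵢ) u<u′
      ; fits = subst (_≤ Y i) (sym uₐ≡u′ᵢ) (proj₂ (inY tr′ row-i)) }

  ascent-free-unique : ∀ {t t′} → IsTransversal k Y t → IsTransversal k Y t′ →
                       ¬ Ascent k Y ρ t → ¬ Ascent k Y ρ t′ → t ≡ t′
  ascent-free-unique {t} {t′} tr tr′ free free′ =
    col-ext t t′ (length≡ tr) (length≡ tr′) (λ {i} → agree (suc (ρ i)) ≤-refl)
    where
      agree : ∀ n {i} → ρ i < n → Row k i → col t i ≡ col t′ i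
      agree (suc n) {i} ρi<n row-i with <-cmp (col t i) (col t′ i)
      ... | tri< t<t′ _ _ = ⊥-elim (no-first-difference tr tr′ free row-i before t<t′)
        where
          before : AgreeBefore t t′ i
          before row-r ρr<ρi = agree n (≤-trans ρr<ρi (s≤s⁻¹ ρi<n)) row-r
      ... | tri≈ _ t≡t′ _ = t≡t′
      ... | tri> _ _ t′<t = ⊥-elim (no-first-difference tr′ tr free′ row-i before t′<t)
        where
          before : AgreeBefore t′ t i
          before row-r ρr<ρi = sym (agree n (≤-trans ρr<ρi (s≤s⁻¹ ρi<n)) row-r)

transpose : ℕ → ℕ → ℕ → ℕ
transpose r s i with i ≟ r | i ≟ s
... | yes _ | _     = s
... | no  _ | yes _ = r
... | no  _ | no  _ = i

transpose-r : ∀ r s → transpose r s r ≡ s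
transpose-r r s with r ≟ r
... | yes _   = refl
... | no  r≢r = ⊥-elim (r≢r refl)

transpose-s : ∀ r s → transpose r s s ≡ r
transpose-s r s with s ≟ r | s ≟ s
... | yes s≡r | _       = s≡r
... | no  _   | yes _   = refl
... | no  _   | no  s≢s = ⊥-elim (s≢s refl)

transpose-fixed : ∀ {r s i} → i ≢ r → i ≢ s → transpose r s i ≡ i
transpose-fixed {r} {s} {i} i≢r i≢s with i ≟ r | i ≟ s
... | yes i≡r | _       = ⊥-elim (i≢r i≡r)
... | no  _   | yes i≡s = ⊥-elim (i≢s i≡s)
... | no  _   | no  _   = refl

transpose-involutive : ∀ r s i → transpose r s (transpose r s i) ≡ i
transpose-involutive r s i with i ≟ r | i ≟ s
... | yes refl | _        = transpose-s r s
... | no  _    | yes refl = transpose-r r s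
... | no  i≢r  | no  i≢s  = transpose-fixed i≢r i≢s

transpose-row : ∀ {k r s i} → Row k r → Row k s → Row k i → Row k (transpose r s i)
transpose-row {k} {r} {s} {i} row-r row-s row-i with i ≟ r | i ≟ s
... | yes refl | _        = row-s
... | no  _    | yes refl = row-r
... | no  _    | no  _    = row-i

exchange : ℕ → List ℕ → ℕ → ℕ → List ℕ
exchange k t r s = columns k (col t ∘ transpose r s)

col-exchange : ∀ {k} t r s {i} → Row k i → col (exchange k t r s) i ≡ col t (transpose r s i)
col-exchange t r s = col-columns (col t ∘ transpose r s)

exchange-transversal : ∀ {k Y t r s} → IsTransversal k Y t → Row k r → Row k s →
                       col t s ≤ Y r → col t r ≤ Y s → IsTransversal k Y (exchange k t r s)
exchange-transversal {k} {Y} {t} {r} {s} tr row-r row-s tₛ≤Yᵣ tᵣ≤Yₛ = record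
  { length≡    = length-applyUpTo (col t ∘ transpose r s ∘ suc) k
  ; inY        = λ row-i → subst (Row (Y _)) (sym (col-exchange t r s row-i)) (moved row-i)
  ; surjective = surjective′
  ; injective  = injective′ }
  where
    τ : ℕ → ℕ
    τ = transpose r s

    moved : ∀ {i} → Row k i → Row (Y i) (col t (τ i))
    moved {i} row-i with i ≟ r | i ≟ s
    ... | yes refl | _        = proj₁ (inY tr row-s) , tₛ≤Yᵣ
    ... | no  _    | yes refl = proj₁ (inY tr row-r) , tᵣ≤Yₛ
    ... | no  _    | no  _    = inY tr row-i

    surjective′ : ∀ {j} → Row k j → ∃[ i ] Row k i × col (exchange k t r s) i ≡ j
    surjective′ row-j =
      let a , row-a , tₐ≡j = surjective tr row-j
          row-τa = transpose-row row-r row-s row-a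
      in τ a , row-τa , trans (col-exchange t r s row-τa) (trans (cong (col t) (transpose-involutive r s a)) tₐ≡j)

    injective′ : ∀ {i i′} → Row k i → Row k i′ →
                 col (exchange k t r s) i ≡ col (exchange k t r s) i′ → i ≡ i′
    injective′ {i} {i′} row-i row-i′ same =
      let τi≡τi′ = injective tr (transpose-row row-r row-s row-i) (transpose-row row-r row-s row-i′)
                     (trans (sym (col-exchange t r s row-i)) (trans same (col-exchange t r s row-i′)))
      in trans (sym (transpose-involutive r s i))
               (trans (cong τ τi≡τi′) (transpose-involutive r s i′))

sum-cong : ∀ {xs} (f g : ℕ → ℕ) → (∀ {x} → x ∈ xs → f x ≡ g x) → sum (map f xs) ≡ sum (map g xs)
sum-cong f g same = cong sum (map-cong-local (All.tabulate same))

private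
  swap-outer : ∀ a b c → a + b + c ≡ c + b + a
  swap-outer = solve-∀

  swap-middle : ∀ a b c d → (a + b) + (c + d) ≡ (a + c) + (b + d)
  swap-middle = solve-∀

  rotate : ∀ a b c d → (a + b) + (c + d) ≡ (c + a) + (b + d)
  rotate = solve-∀

sum-update : ∀ {xs r} (f g : ℕ → ℕ) → Unique xs → r ∈ xs → (∀ {x} → x ∈ xs → x ≢ r → f x ≡ g x) →
             sum (map f xs) + g r ≡ sum (map g xs) + f r
sum-update {x ∷ xs} f g (x∉xs AllPairs.∷ _) (here refl) same = begin
  f x + sum (map f xs) + g x  ≡⟨ cong (λ z → f x + z + g x) (sum-cong f g rest) ⟩
  f x + sum (map g xs) + g x  ≡⟨ swap-outer (f x) _ (g x) ⟩
  g x + sum (map g xs) + f x  ∎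
  where
    rest : ∀ {y} → y ∈ xs → f y ≡ g y
    rest y∈ = same (there y∈) (λ y≡x → All.lookup x∉xs y∈ (sym y≡x))
sum-update {x ∷ xs} {r} f g (x∉xs AllPairs.∷ unique) (there r∈) same = begin
  f x + sum (map f xs) + g r    ≡⟨ +-assoc (f x) _ (g r) ⟩
  f x + (sum (map f xs) + g r)  ≡⟨ cong₂ _+_ (same (here refl) (All.lookup x∉xs r∈))
                                             (sum-update f g unique r∈ (same ∘ there)) ⟩
  g x + (sum (map g xs) + f r)  ≡⟨ +-assoc (g x) _ (f r) ⟨
  g x + sum (map g xs) + f r    ∎

sum-exchange : ∀ {xs r s} (f g : ℕ → ℕ) → Unique xs → r ∈ xs → s ∈ xs → r ≢ s →
               (∀ {x} → x ∈ xs → x ≢ r → x ≢ s → f x ≡ g x) →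
               sum (map f xs) + (g r + g s) ≡ sum (map g xs) + (f r + f s)
sum-exchange {x ∷ xs} f g (x∉xs AllPairs.∷ unique) (here refl) (here refl) r≢s same = ⊥-elim (r≢s refl)
sum-exchange {x ∷ xs} f g (x∉xs AllPairs.∷ unique) (here refl) (there s∈) r≢s same =
  head-first f g x∉xs unique s∈ same
  where
    head-first : ∀ {x xs s} (f g : ℕ → ℕ) → All (x ≢_) xs → Unique xs → s ∈ xs →
                 (∀ {y} → y ∈ x ∷ xs → y ≢ x → y ≢ s → f y ≡ g y) →
                 (f x + sum (map f xs)) + (g x + g s) ≡ (g x + sum (map g xs)) + (f x + f s)
    head-first {x} {xs} {s} f g x∉xs unique s∈ same = begin
      (f x + sum (map f xs)) + (g x + g s)  ≡⟨ swap-middle (f x) _ (g x) (g s) ⟩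
      (f x + g x) + (sum (map f xs) + g s)  ≡⟨ cong (f x + g x +_) (sum-update f g unique s∈ rest) ⟩
      (f x + g x) + (sum (map g xs) + f s)  ≡⟨ rotate (g x) _ (f x) (f s) ⟨
      (g x + sum (map g xs)) + (f x + f s)  ∎
      where
        rest : ∀ {y} → y ∈ xs → y ≢ s → f y ≡ g y
        rest y∈ = same (there y∈) (λ y≡x → All.lookup x∉xs y∈ (sym y≡x))
sum-exchange {x ∷ xs} {r} f g (x∉xs AllPairs.∷ unique) (there r∈) (here refl) r≢s same = begin
  (f x + sum (map f xs)) + (g r + g x)  ≡⟨ cong (f x + sum (map f xs) +_) (+-comm (g r) (g x)) ⟩
  (f x + sum (map f xs)) + (g x + g r)  ≡⟨ sum-exchange f g (x∉xs AllPairs.∷ unique) (here refl) (there r∈)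
                                              (≢-sym r≢s) (λ y∈ y≢x y≢r → same y∈ y≢r y≢x) ⟩
  (g x + sum (map g xs)) + (f x + f r)  ≡⟨ cong (g x + sum (map g xs) +_) (+-comm (f x) (f r)) ⟩
  (g x + sum (map g xs)) + (f r + f x)  ∎
sum-exchange {x ∷ xs} {r} {s} f g (x∉xs AllPairs.∷ unique) (there r∈) (there s∈) r≢s same = begin
  f x + sum (map f xs) + (g r + g s)    ≡⟨ +-assoc (f x) _ _ ⟩
  f x + (sum (map f xs) + (g r + g s))  ≡⟨ cong₂ _+_ (same (here refl) (All.lookup x∉xs r∈) (All.lookup x∉xs s∈))
                                                    (sum-exchange f g unique r∈ s∈ r≢s (same ∘ there)) ⟩
  g x + (sum (map g xs) + (f r + f s))  ≡⟨ +-assoc (g x) _ _ ⟨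
  g x + sum (map g xs) + (f r + f s)    ∎

rearrangement : ∀ {x y u v} → x < y → u < v → x * v + y * u < x * u + y * v
rearrangement {x} {u = u} x<y u<v
  with d , refl ← m≤n⇒∃[o]m+o≡n x<y | e , refl ← m≤n⇒∃[o]m+o≡n u<v =
  subst (x * (1 + u + e) + (1 + x + d) * u <_) (sym (expand x u d e))
        (m<m+n (x * (1 + u + e) + (1 + x + d) * u) (s≤s z≤n))
  where
    expand : ∀ x u d e → x * u + (1 + x + d) * (1 + u + e) ≡
                         (x * (1 + u + e) + (1 + x + d) * u) + (1 + d) * (1 + e)
    expand = solve-∀

cancel-< : ∀ {a b x z} → a + x ≡ b + z → x < z → b < a
cancel-< a+x≡b+z x<z = ≰⇒> (λ a≤b → <-irrefl a+x≡b+z (+-mono-≤-< a≤b x<z))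

weight : ℕ → (ℕ → ℕ) → List ℕ → ℕ
weight k ρ t = sum (map (λ i → ρ i * col t i) (range 1 k))

exchange-lowers-weight : ∀ {k t r s} (ρ : ℕ → ℕ) → Row k r → Row k s → ρ r < ρ s → col t r < col t s →
                         weight k ρ (exchange k t r s) < weight k ρ t
exchange-lowers-weight {k} {t} {r} {s} ρ row-r row-s ρr<ρs tᵣ<tₛ =
  cancel-< two-entries-change (subst₂ (λ p q → p + q < f r + f s) (sym g-at-r) (sym g-at-s)
                                      (rearrangement ρr<ρs tᵣ<tₛ))
  where
    f g : ℕ → ℕ
    f i = ρ i * col t i
    g i = ρ i * col t (transpose r s i)

    g-at-r : g r ≡ ρ r * col t s
    g-at-r = cong (λ i → ρ r * col t i) (transpose-r r s)
    g-at-s : g s ≡ ρ s * col t r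
    g-at-s = cong (λ i → ρ s * col t i) (transpose-s r s)

    weight-exchange : weight k ρ (exchange k t r s) ≡ sum (map g (range 1 k))
    weight-exchange = sum-cong {range 1 k} (λ i → ρ i * col (exchange k t r s) i) g
                        (λ i∈ → cong (ρ _ *_) (col-exchange t r s (to (∈-range {k}) i∈)))

    two-entries-change : weight k ρ t + (g r + g s) ≡ weight k ρ (exchange k t r s) + (f r + f s)
    two-entries-change =
      trans (sum-exchange f g (range-unique k) (from ∈-range row-r) (from ∈-range row-s)
               (λ r≡s → <-irrefl (cong ρ r≡s) ρr<ρs)
               (λ _ i≢r i≢s → cong (λ j → ρ _ * col t j) (sym (transpose-fixed i≢r i≢s))))
            (cong (_+ (f r + f s)) (sym weight-exchange))

descend : {A : Set} (μ : A → ℕ) (Good : A → Set) (bad : A → Bool) →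
          (∀ {a} → Good a → T (bad a) → ∃[ b ] Good b × μ b < μ a) →
          ∀ {a} → Good a → ∃[ b ] Good b × ¬ T (bad b)
descend μ Good bad improve good = go (<-wellFounded _) good
  where
    go : ∀ {a} → Acc _<_ (μ a) → Good a → ∃[ b ] Good b × ¬ T (bad b)
    go {a} (acc smaller) good-a with T? (bad a)
    ... | no  fine = a , good-a , fine
    ... | yes worse = let b , good-b , μb<μa = improve good-a worse in go (smaller μb<μa) good-b

-- For a pattern detected by a ranking, avoiding transversals exist as soon as
-- any transversal exists (exchange ascents until the weight cannot drop) and
-- are unique.
module _ {k : ℕ} {Y : ℕ → ℕ} {M : Mat₂} {ρ : ℕ → ℕ} (young : IsYoung k Y) (detects : Detects k Y M ρ) where

  open Detects detects

  avoider-exists : ∀ {t} → IsTransversal k Y t → ∃[ t′ ] IsTransversal k Y t′ × ¬ T (contains₂ k Y t′ M)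
  avoider-exists = descend (weight k ρ) (IsTransversal k Y) (λ t → contains₂ k Y t M) improve
    where
      improve : ∀ {t} → IsTransversal k Y t → T (contains₂ k Y t M) →
                ∃[ t′ ] IsTransversal k Y t′ × weight k ρ t′ < weight k ρ t
      improve {t} tr occurs =
        let open Ascent (to (contains⇔ascent tr) occurs)
        in exchange k t i a
         , exchange-transversal tr row-i row-a fits (≤-trans (<⇒≤ smaller) (proj₂ (inY tr row-a)))
         , exchange-lowers-weight {t = t} ρ row-i row-a ranked smaller

  avoider-unique : ∀ {t t′} → IsTransversal k Y t → IsTransversal k Y t′ →
                   ¬ T (contains₂ k Y t M) → ¬ T (contains₂ k Y t′ M) → t ≡ t′
  avoider-unique tr tr′ avoids avoids′ =
    ascent-free-unique young ρ-injective tr tr′ (avoids ∘ from (contains⇔ascent tr))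
                                              (avoids′ ∘ from (contains⇔ascent tr′))

admissible : ℕ → (ℕ → ℕ) → (ℕ → Bool) → (ℕ → Bool) → Mat₂ → List ℕ → Bool
admissible k Y A D M t = isTransversal k Y t ∧ isValid k A D t ∧ not (contains₂ k Y t M)

T-not : ∀ {x} → T (not x) ⇔ (¬ T x)
T-not {false} = mk⇔ (λ _ ()) (λ _ → _)
T-not {true}  = mk⇔ (λ ()) (λ never → never _)

admissible⇔ : ∀ {k Y A D M t} → IsYoung k Y →
              T (admissible k Y A D M t) ⇔ (IsTransversal k Y t × T (isValid k A D t) × ¬ T (contains₂ k Y t M))
admissible⇔ {k} {Y} {A} {D} {M} {t} young = mk⇔
  (λ h → let tr , h′ = ∧-split (isTransversal k Y t) h ; valid , avoids = ∧-split (isValid k A D t) h′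
         in to (isTransversal⇔ young) tr , valid , to T-not avoids)
  (λ (tr , valid , avoids) → ∧-join (from (isTransversal⇔ young) tr) (∧-join valid (from T-not avoids)))

-- When validity imposes no constraint, two patterns detected by rankings are
-- avoided by equally many transversals: each count is 1 if Y has a
-- transversal and 0 otherwise.
detected-patterns-equinumerous :
  ∀ {k Y A D M M′ ρ ρ′} → IsYoung k Y → Detects k Y M ρ → Detects k Y M′ ρ′ →
  (∀ t → T (isValid k A D t)) → countS k Y A D M ≡ countS k Y A D M′
detected-patterns-equinumerous {k} {Y} {A} {D} {M} {M′} young detects detects′ valid =
  count-equal (admissible k Y A D M) (admissible k Y A D M′) (candidates-unique k Y)
    (at-most-one detects) (at-most-one detects′) (transfer {M} detects′) (transfer {M′} detects)
  where
    at-most-one : ∀ {N ρ} → Detects k Y N ρ → AtMostOne (admissible k Y A D N) (candidates k Y)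
    at-most-one {N} detects-N {s} {s′} _ _ h h′ =
      let tr , _ , avoids = to (admissible⇔ {A = A} {D} {M = N} {t = s} young) h
          tr′ , _ , avoids′ = to (admissible⇔ {A = A} {D} {M = N} {t = s′} young) h′
      in avoider-unique young detects-N tr tr′ avoids avoids′
    transfer : ∀ {N N′ ρ} → Detects k Y N′ ρ → ∀ {s} → s ∈ candidates k Y → T (admissible k Y A D N s) →
               ∃[ t ] t ∈ candidates k Y × T (admissible k Y A D N′ t)
    transfer {N} {N′} detects-N′ {s} _ h =
      let t , tr , avoids = avoider-exists young detects-N′ (proj₁ (to (admissible⇔ {A = A} {D} {M = N} {t = s} young) h))
      in t , transversal∈candidates tr , from (admissible⇔ {A = A} {D} {M = N′} {t = t} young) (tr , valid t , avoids)

row-below : ∀ {k i} → i + 1 ≤ k → Row k (suc i)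
row-below {k} {i} i+1≤k = s≤s z≤n , subst (_≤ k) (+-comm i 1) i+1≤k

row-above : ∀ {k i} → 1 ≤ i → i + 1 ≤ k → Row k i
row-above {i = i} 1≤i i+1≤k = 1≤i , m+n≤o⇒m≤o i i+1≤k

valid-at : ∀ {k A D t i} → T (isValid k A D t) → 1 ≤ i → i + 1 ≤ k →
           (A i ≡ true → col t i < col t (suc i)) × (D i ≡ true → col t (suc i) < col t i)
valid-at {k} {A} {D} {t} {i} valid 1≤i i+1≤k =
  (λ Ai → <ᵇ⇒< _ _ (implies (proj₁ conditions) Ai)) , (λ Di → <ᵇ⇒< _ _ (implies (proj₂ conditions) Di))
  where
    implies : ∀ {b x} → T (not b ∨ x) → b ≡ true → T x
    implies h refl = h
    i≤k-1 : i ≤ k ∸ 1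
    i≤k-1 = subst (_≤ k ∸ 1) (m+n∸n≡m i 1) (∸-monoˡ-≤ 1 i+1≤k)
    conditions : T (not (A i) ∨ (col t i <ᵇ col t (suc i))) × T (not (D i) ∨ (col t (suc i) <ᵇ col t i))
    conditions = ∧-split (not (A i) ∨ (col t i <ᵇ col t (suc i)))
                   (to (forallIn⇔ (k ∸ 1) _) valid (1≤i , i≤k-1))

-- If some i lies in A, then 1-alternation puts i + 1 in D, and every valid
-- transversal ascends from row i to i + 1 (an occurrence of I₂) and descends
-- from row i + 1 to i + 2, whose lengths agree (an occurrence of J₂).
forced-occurrences : ∀ {k Y A D i t} → IsADYoung k Y A D → IsOneAlternating k A D → A i ≡ true →
                     IsTransversal k Y t → T (isValid k A D t) →
                     T (contains₂ k Y t I₂) × T (contains₂ k Y t J₂)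
forced-occurrences {k} {Y} {A} {D} {i} {t} (young , A⊆ , D⊆ , _ , equalRows) alternating Ai tr valid =
  from (Detects.contains⇔ascent (I₂-detected young) tr) ascent-I₂ ,
  from (Detects.contains⇔ascent J₂-detected tr) ascent-J₂
  where
    1≤i : 1 ≤ i
    1≤i = proj₁ (A⊆ i Ai)
    i+1≤k : i + 1 ≤ k
    i+1≤k = proj₂ (A⊆ i Ai)
    Dsi : D (suc i) ≡ true
    Dsi = to (alternating i i+1≤k) Ai
    i+2≤k : suc i + 1 ≤ k
    i+2≤k = proj₂ (D⊆ (suc i) Dsi)
    row-i : Row k i
    row-i = row-above 1≤i i+1≤k
    row-i+1 : Row k (suc i)
    row-i+1 = row-below i+1≤k
    row-i+2 : Row k (suc (suc i))
    row-i+2 = row-below i+2≤k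

    ascent-I₂ : Ascent k Y (λ r → r) t
    ascent-I₂ = record
      { i = i ; a = suc i ; row-i = row-i ; row-a = row-i+1 ; ranked = n<1+n i
      ; smaller = proj₁ (valid-at {k} {A} {D} {t} valid 1≤i i+1≤k) Ai
      ; fits = ≤-trans (proj₂ (inY tr row-i+1)) (young-mono young row-i (n≤1+n i) (proj₂ row-i+1)) }

    equal-lengths : Y (suc i) ≡ Y (suc (suc i))
    equal-lengths = equalRows (suc i) (subst (λ d → A (suc i) ∨ d ≡ true) (sym Dsi) (∨-zeroʳ (A (suc i))))

    ascent-J₂ : Ascent k Y (k ∸_) t
    ascent-J₂ = record
      { i = suc (suc i) ; a = suc i ; row-i = row-i+2 ; row-a = row-i+1
      ; ranked = ∸-monoʳ-< (n<1+n (suc i)) (proj₂ row-i+2)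
      ; smaller = proj₂ (valid-at {k} {A} {D} {t} valid (s≤s z≤n) i+2≤k) Dsi
      ; fits = subst (col t (suc i) ≤_) equal-lengths (proj₂ (inY tr row-i+1)) }

unconstrained : ∀ {k Y A D} → IsADYoung k Y A D → IsOneAlternating k A D →
                ¬ T (existsIn 1 k A) → ∀ t → T (isValid k A D t)
unconstrained {k} {Y} {A} {D} (_ , A⊆ , D⊆ , _ , _) alternating no-A t =
  from (forallIn⇔ (k ∸ 1) _) (λ {i} _ → ∧-join (vacuous (A-empty i)) (vacuous (D-empty i)))
  where
    vacuous : ∀ {b x} → b ≡ false → T (not b ∨ x)
    vacuous refl = _
    A-empty : ∀ i → A i ≡ false
    A-empty i with A i in Ai
    ... | false = refl
    ... | true  = ⊥-elim (no-A (from (existsIn⇔ k A)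
                    (i , row-above (proj₁ (A⊆ i Ai)) (proj₂ (A⊆ i Ai)) , from T-≡ Ai)))
    D-empty : ∀ i → D i ≡ false
    D-empty i with D i in Di
    ... | false = refl
    D-empty zero    | true = ⊥-elim (<-irrefl refl (proj₁ (D⊆ zero Di)))
    D-empty (suc i) | true
      with () ← trans (sym (from (alternating i (≤-trans (n≤1+n _) (proj₂ (D⊆ (suc i) Di)))) Di)) (A-empty i)

lemma4p2 : (k : ℕ) (Y : ℕ → ℕ) (A D : ℕ → Bool) →
    IsADYoung k Y A D → IsOneAlternating k A D →
    countS k Y A D I₂ ≡ countS k Y A D J₂
lemma4p2 k Y A D ad@(young , _) alternating with T? (existsIn 1 k A)
... | no  no-A   =
  detected-patterns-equinumerous {A = A} {D} young (I₂-detected young) J₂-detected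
    (unconstrained ad alternating no-A)
... | yes some-A = trans (avoided-by-none I₂ (λ _ → proj₁)) (sym (avoided-by-none J₂ (λ _ → proj₂)))
  where
    Ai : A (proj₁ (to (existsIn⇔ k A) some-A)) ≡ true
    Ai = to T-≡ (proj₂ (proj₂ (to (existsIn⇔ k A) some-A)))

    avoided-by-none : ∀ M → (∀ t → T (contains₂ k Y t I₂) × T (contains₂ k Y t J₂) → T (contains₂ k Y t M)) →
                      countS k Y A D M ≡ 0
    avoided-by-none M select = count≡0 (admissible k Y A D M) {candidates k Y} λ {t} _ h →
      let tr , valid , avoids = to (admissible⇔ {A = A} {D} {M} {t} young) h
      in avoids (select t (forced-occurrences {A = A} {D} {t = t} ad alternating Ai tr valid))
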